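{- Let $n=p_1p_2p_3$ ($p_i$ distinct primes), $\gcd(n,6)=1$, $n>1000$, $G$ cyclic of order $n$, $\mathrm{ord}(g)=n$. Let $a,b,c$ be integers with $1+c=a+b$ and $1<c<\frac n2<n-b\le n-a<n-1$, such that $S=(g)\cdot(cg)\cdot((n-b)g)\cdot((n-a)g)$ is a reduced minimal zero-sum sequence and one of (A2), (A3), (A4) below holds. Let $s=\lfloor b/a\rfloor$ and assume $s\le9$ and condition (B). If $4<\frac nc\le5<\frac nb<6$ and $5\mid n$, then $\mathrm{ind}(S)=1$.
   Context: Minimal zero-sum sequence: a finite unordered sequence of elements of $G$ whose terms sum to $0$ and no proper nonempty subsequence of which sums to $0$. $S$ is reduced if for every prime $p\mid n$ the sequence $(pg)\cdot(pcg)\cdot(p(n-b)g)\cdot(p(n-a)g)$ is not minimal zero-sum. For a generator $h$ of $G$, write $S=(m_1h)\cdots(m_4h)$ with $m_j\in[1,n]$, $\|S\|_h=(m_1+\cdots+m_4)/n$, $\mathrm{ind}(S)=\min\{\|S\|_h:\langle h\rangle=G\}$. Conditions (for a suitable labeling of the primes): (A2) $\{\gcd(c,n),\gcd(b,n),\gcd(a,n)\}=\{p_1,p_2,p_1p_2\}$; (A3) $\gcd(c+1,n)=p_1p_2$, $\gcd(b-1,n)=p_1p_3$, $\gcd(a-1,n)=p_2p_3$; (A4) $\gcd(c,n)=p_1p_2$, $\gcd(b,n)=p_1p_3$, $\gcd(a,n)=p_2p_3$. Condition (B): for every integer $t$ with $0\le t\le\lfloor s/2\rfloor-1$, the interval $[\frac{(2s-2t-1)n}{2b},\frac{(s-t)n}{b}]$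 contains no integer coprime to $n$. -}

module Defs where

open import Data.Nat as ℕ using (ℕ)
open import Data.Nat.Primality using (Prime)
open import Data.Nat.Divisibility as ℕD using ()
open import Data.Nat.Coprimality using (Coprime)
open import Data.Integer using (ℤ; +_; _+_; _-_; _*_; _≤_; _<_; ∣_∣; _/ℕ_)
open import Data.Integer.Divisibility using (_∣_)
open import Data.Integer.GCD using (gcd)
open import Data.Fin using (Fin; zero; suc)
open import Data.Bool using (Bool; true; false; if_then_else_)
open import Data.Product using (Σ; ∃; _×_)
open import Data.Sum using (_⊎_)
open import Relation.Binary.PropositionalEquality using (_≡_; _≢_)
open import Relation.Nullary using (¬_)

-- The cyclic group G of order n is modelled as ℤ/nℤ: an element is
-- represented by an integer, and two integers denote the same element
-- iff they are congruent modulo n.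

infix 4 _≋_[mod_]
_≋_[mod_] : ℤ → ℤ → ℕ → Set
x ≋ y [mod n ] = (+ n) ∣ (x - y)

HasOrder : ℕ → ℤ → ℕ → Set
HasOrder n g k =
  (0 ℕ.< k) × ((+ k) * g ≋ + 0 [mod n ]) ×
  (∀ j → 0 ℕ.< j → j ℕ.< k → ¬ ((+ j) * g ≋ + 0 [mod n ]))

Generates : ℕ → ℤ → Set
Generates n h = ∀ (x : ℤ) → ∃ λ (k : ℤ) → x ≋ k * h [mod n ]

-- Sequences of length 4 over G (terms indexed by Fin 4).  A
-- subsequence is given by a choice of a subset of the index set.

Seq4 : Set
Seq4 = Fin 4 → ℤ

Sub4 : Set
Sub4 = Fin 4 → Bool

pick : Bool → ℤ → ℤ
pick β x = if β then x else + 0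

sum4 : Seq4 → ℤ
sum4 S = S zero + S (suc zero) + S (suc (suc zero)) + S (suc (suc (suc zero)))

subSum : Sub4 → Seq4 → ℤ
subSum T S = sum4 (λ i → pick (T i) (S i))

NonemptyProper : Sub4 → Set
NonemptyProper T = (∃ λ i → T i ≡ true) × (∃ λ i → T i ≡ false)

ZeroSum : ℕ → Seq4 → Set
ZeroSum n S = sum4 S ≋ + 0 [mod n ]

MinimalZeroSum : ℕ → Seq4 → Set
MinimalZeroSum n S =
  ZeroSum n S × (∀ (T : Sub4) → NonemptyProper T → ¬ (subSum T S ≋ + 0 [mod n ]))

mkS : ℕ → ℤ → ℤ → ℤ → ℤ → Seq4
mkS n g a b c zero = g
mkS n g a b c (suc zero) = c * g
mkS n g a b c (suc (suc zero)) = ((+ n) - b) * g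
mkS n g a b c (suc (suc (suc zero))) = ((+ n) - a) * g

Reduced : ℕ → ℤ → ℤ → ℤ → ℤ → Set
Reduced n g a b c =
  ∀ (p : ℕ) → Prime p → p ℕD.∣ n →
    ¬ MinimalZeroSum n (λ i → (+ p) * mkS n g a b c i)

-- For a generator h, the coefficient of x w.r.t. h is the
-- (unique) m ∈ [1,n] with x = m h.  ‖S‖_h = (m₁+⋯+m₄)/n.
-- IndexNumerator n S N  means  ind(S) = N / n, i.e. N is the minimum of
-- m₁+⋯+m₄ over all generators h of G.

Coeff : ℕ → ℤ → ℤ → ℤ → Set
Coeff n h x m = (+ 1 ≤ m) × (m ≤ + n) × (x ≋ m * h [mod n ])

NormNumerator : ℕ → ℤ → Seq4 → ℤ → Set
NormNumerator n h S N =
  ∃ λ (m : Fin 4 → ℤ) → (∀ i → Coeff n h (S i) (m i)) × (N ≡ sum4 m)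

IndexNumerator : ℕ → Seq4 → ℤ → Set
IndexNumerator n S N =
  (∃ λ (h : ℤ) → Generates n h × NormNumerator n h S N) ×
  (∀ (h : ℤ) → Generates n h → ∀ (M : ℤ) → NormNumerator n h S M → N ≤ M)

IndexOne : ℕ → Seq4 → Set
IndexOne n S = IndexNumerator n S (+ n)

-- Conditions (A2), (A3), (A4), "for a suitable labeling of the primes":
-- there are distinct primes q₁ q₂ q₃ with n = q₁ q₂ q₃ (i.e. a relabeling
-- of p₁ p₂ p₃) satisfying the condition.

DistinctPrimeTriple : ℕ → ℕ → ℕ → ℕ → Set
DistinctPrimeTriple n q₁ q₂ q₃ =
  Prime q₁ × Prime q₂ × Prime q₃ ×
  q₁ ≢ q₂ × q₁ ≢ q₃ × q₂ ≢ q₃ × n ≡ q₁ ℕ.* q₂ ℕ.* q₃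

_∈₃_ : ℤ → (ℤ × ℤ × ℤ) → Set
x ∈₃ (u Data.Product., v Data.Product., w) = x ≡ u ⊎ x ≡ v ⊎ x ≡ w

SetEq₃ : (ℤ × ℤ × ℤ) → (ℤ × ℤ × ℤ) → Set
SetEq₃ X@(x Data.Product., y Data.Product., z) Y@(u Data.Product., v Data.Product., w) =
  (x ∈₃ Y) × (y ∈₃ Y) × (z ∈₃ Y) × (u ∈₃ X) × (v ∈₃ X) × (w ∈₃ X)

CondA2 : ℕ → ℤ → ℤ → ℤ → Set
CondA2 n a b c = ∃ λ q₁ → ∃ λ q₂ → ∃ λ q₃ → DistinctPrimeTriple n q₁ q₂ q₃ ×
  SetEq₃ (gcd c (+ n) Data.Product., gcd b (+ n) Data.Product., gcd a (+ n))
         (+ q₁ Data.Product., + q₂ Data.Product., + (q₁ ℕ.* q₂))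

CondA3 : ℕ → ℤ → ℤ → ℤ → Set
CondA3 n a b c = ∃ λ q₁ → ∃ λ q₂ → ∃ λ q₃ → DistinctPrimeTriple n q₁ q₂ q₃ ×
  (gcd (c + + 1) (+ n) ≡ + (q₁ ℕ.* q₂)) ×
  (gcd (b - + 1) (+ n) ≡ + (q₁ ℕ.* q₃)) ×
  (gcd (a - + 1) (+ n) ≡ + (q₂ ℕ.* q₃))

CondA4 : ℕ → ℤ → ℤ → ℤ → Set
CondA4 n a b c = ∃ λ q₁ → ∃ λ q₂ → ∃ λ q₃ → DistinctPrimeTriple n q₁ q₂ q₃ ×
  (gcd c (+ n) ≡ + (q₁ ℕ.* q₂)) ×
  (gcd b (+ n) ≡ + (q₁ ℕ.* q₃)) ×
  (gcd a (+ n) ≡ + (q₂ ℕ.* q₃))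

-- Condition (B): for every integer t with 0 ≤ t ≤ ⌊s/2⌋ - 1, the real
-- interval [(2s-2t-1)n/(2b), (s-t)n/b] contains no integer coprime to n.
-- Since b > 0 (forced by the hypotheses of the theorem), x lies in the
-- interval iff (2s-2t-1)n ≤ 2b·x and b·x ≤ (s-t)n.

CondB : ℕ → ℤ → ℤ → Set
CondB n b s =
  ∀ (t : ℤ) → + 0 ≤ t → t ≤ (s /ℕ 2) - + 1 →
  ∀ (x : ℤ) →
    ((+ 2 * s - + 2 * t - + 1) * + n ≤ + 2 * b * x) →
    (b * x ≤ (s - t) * + n) →
    ¬ Coprime ∣ x ∣ n

module Submission where

-- Lemma 4.2.  Write n = 5m and model G as ℤ/nℤ, with g a unit.
--
--  1. c = m.  Otherwise the terms of 5·S, written as multiples of 5g (an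
--     element of order m), have positive coefficients 1, c − m, m − b,
--     m − a summing to m; then 5·S is a minimal zero-sum sequence and S
--     would not be reduced.
--  2. Hence a = 1 + D and b = m − D with D ≥ 1 and 6D < m (from 6b > n).
--     Writing n = 5qr with q, r odd primes, some U ≡ 1 (mod 5) among
--     5J + 6, 5J + 11, 5J + 16 (J = ⌊m/5D⌋) is prime to q and r, and all
--     three satisfy m < UD and U + UD < 5m.
--  3. For the generator h = U⁻¹·g, S = (Uh)(mh)((UD − m)h)((5m − U − UD)h)
--     has coefficients in [1, n] summing to n.  As ‖S‖_h ≥ 1 for every
--     zero-sum S and every generator h, this gives ind(S) = 1.

open import Defs
open import Data.Nat as ℕ using (ℕ; zero; suc; z≤n; s≤s)
import Data.Nat.Properties as ℕP
import Data.Nat.Tactic.RingSolver as ℕSolver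
open import Data.Nat.Divisibility as ℕD using (divides) renaming (_∣_ to _∣ℕ_)
open import Data.Nat.Coprimality as Coprimality using (Coprime)
open import Data.Nat.DivMod using (_/_; _%_; m≡m%n+[m/n]*n; m%n<n)
open import Data.Nat.Primality using (Prime; prime?; ¬prime[1]; euclidsLemma; prime⇒irreducible)
open import Data.Nat.GCD using (gcd; gcd[m,n]∣m; gcd[m,n]∣n; module Bézout)
open import Data.Integer using (ℤ; +_; -[1+_]; _+_; _-_; _*_; _≤_; _<_; -_; ∣_∣; +≤+; +<+)
import Data.Integer.Properties as ℤP
open import Data.Integer.Divisibility.Signed as ℤD
  using (∣ᵤ⇒∣; ∣⇒∣ᵤ; ∣m∣n⇒∣m+n; ∣m∣n⇒∣m-n; ∣n⇒∣m*n; ∣m⇒∣m*n)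
  renaming (_∣_ to _∣ₛ_; divides to dividesₛ)
open import Data.Integer.Tactic.RingSolver using (solve-∀)
open import Data.Fin using (zero; suc)
open import Data.Bool using (true; false; not)
open import Data.Product using (Σ; ∃; ∃₂; _×_; _,_; proj₁; proj₂)
open import Data.Sum using (_⊎_; inj₁; inj₂)
open import Data.Empty using (⊥; ⊥-elim)
open import Relation.Nullary using (¬_; yes; no)
open import Relation.Nullary.Decidable using (toWitness)
open import Relation.Binary.PropositionalEquality hiding (J)
open ≡-Reasoning

-- Inequalities are proved by certificates: the difference of the two
-- sides is rewritten, by a ring identity, as a sum of products of
-- quantities already known to be nonnegative.
NonNeg : ℤ → Set
NonNeg x = Σ ℕ λ k → x ≡ + k

nonNeg-ℕ : ∀ k → NonNeg (+ k)
nonNeg-ℕ k = k , refl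

nonNeg-+ : ∀ {x y} → NonNeg x → NonNeg y → NonNeg (x + y)
nonNeg-+ (k , refl) (l , refl) = k ℕ.+ l , sym (ℤP.pos-+ k l)

nonNeg-* : ∀ {x y} → NonNeg x → NonNeg y → NonNeg (x * y)
nonNeg-* (k , refl) (l , refl) = k ℕ.* l , sym (ℤP.pos-* k l)

nonNeg-by : ∀ {x y} → x ≡ y → NonNeg y → NonNeg x
nonNeg-by x≡y (k , y≡k) = k , trans x≡y y≡k

≤⇒nonNeg : ∀ {x y} → x ≤ y → NonNeg (y - x)
≤⇒nonNeg {x} {y} x≤y = ∣ y - x ∣ , sym (ℤP.0≤i⇒+∣i∣≡i (ℤP.i≤j⇒0≤j-i x≤y))

<⇒nonNeg : ∀ {x y} → x < y → NonNeg (y - x - + 1)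
<⇒nonNeg {x} {y} x<y = nonNeg-by (shift x y) (≤⇒nonNeg (ℤP.i<j⇒suc[i]≤j x<y))
  where shift : ∀ x y → y - x - + 1 ≡ y - (+ 1 + x)
        shift = solve-∀

nonNeg⇒≤ : ∀ {x y} → NonNeg (y - x) → x ≤ y
nonNeg⇒≤ (k , y-x≡k) = ℤP.0≤i-j⇒j≤i (subst (+ 0 ≤_) (sym y-x≡k) (+≤+ z≤n))

nonNeg⇒< : ∀ {x y} → NonNeg (y - x - + 1) → x < y
nonNeg⇒< {x} {y} y-x-1≥0 = ℤP.suc[i]≤j⇒i<j (nonNeg⇒≤ (nonNeg-by (shift x y) y-x-1≥0))
  where shift : ∀ x y → y - (+ 1 + x) ≡ y - x - + 1
        shift = solve-∀

nonNeg-cancel : ∀ c .{{_ : ℕ.NonZero c}} z → NonNeg (+ c * z) → NonNeg z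
nonNeg-cancel (suc c) (+ k) _ = k , refl
nonNeg-cancel (suc c) -[1+ k ] (_ , ())

module Components (u : Seq4) where
  u₀ u₁ u₂ u₃ : ℤ
  u₀ = u zero
  u₁ = u (suc zero)
  u₂ = u (suc (suc zero))
  u₃ = u (suc (suc (suc zero)))

sum4-≗ : (u v : Seq4) → (∀ i → u i ≡ v i) → sum4 u ≡ sum4 v
sum4-≗ u v u≗v = cong₂ _+_ (cong₂ _+_ (cong₂ _+_ (u≗v zero) (u≗v (suc zero)))
                                        (u≗v (suc (suc zero)))) (u≗v (suc (suc (suc zero))))

sum4-cong : ∀ {k} (u v : Seq4) → (∀ i → k ∣ₛ (u i - v i)) → k ∣ₛ (sum4 u - sum4 v)
sum4-cong {k} u v k∣u-v = subst (k ∣ₛ_) (sym (regroup u₀ u₁ u₂ u₃ v₀ v₁ v₂ v₃))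
  (∣m∣n⇒∣m+n (∣m∣n⇒∣m+n (∣m∣n⇒∣m+n (k∣u-v _) (k∣u-v _)) (k∣u-v _)) (k∣u-v _))
  where
  open Components u
  open Components v renaming (u₀ to v₀; u₁ to v₁; u₂ to v₂; u₃ to v₃)
  regroup : ∀ u₀ u₁ u₂ u₃ v₀ v₁ v₂ v₃ →
            u₀ + u₁ + u₂ + u₃ - (v₀ + v₁ + v₂ + v₃) ≡ (u₀ - v₀) + (u₁ - v₁) + (u₂ - v₂) + (u₃ - v₃)
  regroup = solve-∀

subSum-cong : ∀ {k} T (u v : Seq4) → (∀ i → k ∣ₛ (u i - v i)) → k ∣ₛ (subSum T u - subSum T v)
subSum-cong {k} T u v k∣u-v = sum4-cong (λ i → pick (T i) (u i)) (λ i → pick (T i) (v i)) pick-cong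
  where
  pick-cong : ∀ i → k ∣ₛ (pick (T i) (u i) - pick (T i) (v i))
  pick-cong i with T i
  ... | true  = k∣u-v i
  ... | false = dividesₛ (+ 0) refl

sum4-*ʳ : ∀ (x : Seq4) y → sum4 (λ i → x i * y) ≡ sum4 x * y
sum4-*ʳ x y = distrib u₀ u₁ u₂ u₃ y
  where
  open Components x
  distrib : ∀ u₀ u₁ u₂ u₃ y → u₀ * y + u₁ * y + u₂ * y + u₃ * y ≡ (u₀ + u₁ + u₂ + u₃) * y
  distrib = solve-∀

subSum-*ʳ : ∀ T (x : Seq4) y → subSum T (λ i → x i * y) ≡ subSum T x * y
subSum-*ʳ T x y = trans (sum4-≗ _ _ pick-*ʳ) (sum4-*ʳ (λ i → pick (T i) (x i)) y)
  where
  pick-*ʳ : ∀ i → pick (T i) (x i * y) ≡ pick (T i) (x i) * y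
  pick-*ʳ i with T i
  ... | true  = refl
  ... | false = sym (ℤP.*-zeroˡ y)

subSum-complement : ∀ T (x : Seq4) → subSum T x + subSum (λ i → not (T i)) x ≡ sum4 x
subSum-complement T x = trans (merge u₀ u₁ u₂ u₃ v₀ v₁ v₂ v₃) (sum4-≗ _ _ pick-split)
  where
  open Components (λ i → pick (T i) (x i))
  open Components (λ i → pick (not (T i)) (x i)) renaming (u₀ to v₀; u₁ to v₁; u₂ to v₂; u₃ to v₃)
  pick-split : ∀ i → pick (T i) (x i) + pick (not (T i)) (x i) ≡ x i
  pick-split i with T i
  ... | true  = ℤP.+-identityʳ (x i)
  ... | false = ℤP.+-identityˡ (x i)
  merge : ∀ u₀ u₁ u₂ u₃ v₀ v₁ v₂ v₃ →
          u₀ + u₁ + u₂ + u₃ + (v₀ + v₁ + v₂ + v₃) ≡ (u₀ + v₀) + (u₁ + v₁) + (u₂ + v₂) + (u₃ + v₃)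
  merge = solve-∀

sum4-≥-term : (u : Seq4) → (∀ i → NonNeg (u i)) → ∀ i → NonNeg (sum4 u - u i)
sum4-≥-term u u≥0 zero = nonNeg-by (drop₀ u₀ u₁ u₂ u₃) (nonNeg-+ (nonNeg-+ (u≥0 _) (u≥0 _)) (u≥0 _))
  where
  open Components u
  drop₀ : ∀ u₀ u₁ u₂ u₃ → u₀ + u₁ + u₂ + u₃ - u₀ ≡ u₁ + u₂ + u₃
  drop₀ = solve-∀
sum4-≥-term u u≥0 (suc zero) = nonNeg-by (drop₁ u₀ u₁ u₂ u₃) (nonNeg-+ (nonNeg-+ (u≥0 _) (u≥0 _)) (u≥0 _))
  where
  open Components u
  drop₁ : ∀ u₀ u₁ u₂ u₃ → u₀ + u₁ + u₂ + u₃ - u₁ ≡ u₀ + u₂ + u₃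
  drop₁ = solve-∀
sum4-≥-term u u≥0 (suc (suc zero)) = nonNeg-by (drop₂ u₀ u₁ u₂ u₃) (nonNeg-+ (nonNeg-+ (u≥0 _) (u≥0 _)) (u≥0 _))
  where
  open Components u
  drop₂ : ∀ u₀ u₁ u₂ u₃ → u₀ + u₁ + u₂ + u₃ - u₂ ≡ u₀ + u₁ + u₃
  drop₂ = solve-∀
sum4-≥-term u u≥0 (suc (suc (suc zero))) = nonNeg-by (drop₃ u₀ u₁ u₂ u₃) (nonNeg-+ (nonNeg-+ (u≥0 _) (u≥0 _)) (u≥0 _))
  where
  open Components u
  drop₃ : ∀ u₀ u₁ u₂ u₃ → u₀ + u₁ + u₂ + u₃ - u₃ ≡ u₀ + u₁ + u₂
  drop₃ = solve-∀

subSum-positive : ∀ T (x : Seq4) → (∀ i → + 1 ≤ x i) → ∃ (λ i → T i ≡ true) → + 1 ≤ subSum T x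
subSum-positive T x x≥1 (i , Ti≡true) = nonNeg⇒≤ (nonNeg-by (split (sum4 u) (x i))
    (nonNeg-+ (subst (λ z → NonNeg (sum4 u - z)) picked (sum4-≥-term u u≥0 i))
              (≤⇒nonNeg (x≥1 i))))
  where
  u : Seq4
  u j = pick (T j) (x j)
  plus-one : ∀ y → y ≡ (y - + 1) + + 1
  plus-one = solve-∀
  u≥0 : ∀ j → NonNeg (u j)
  u≥0 j with T j
  ... | true  = nonNeg-by (plus-one (x j)) (nonNeg-+ (≤⇒nonNeg (x≥1 j)) (nonNeg-ℕ 1))
  ... | false = nonNeg-ℕ 0
  picked : u i ≡ x i
  picked rewrite Ti≡true = refl
  split : ∀ s y → s - + 1 ≡ (s - y) + (y - + 1)
  split = solve-∀

small-multiple-nonzero : ∀ {n m d} .{{_ : ℕ.NonZero d}} → n ≡ m ℕ.* d →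
  ∀ g → Coprime ∣ g ∣ n → ∀ x → + 1 ≤ x → x < + m → ¬ (+ n ∣ₛ x * (+ d * g))
small-multiple-nonzero {n} {m} {d} n≡md g g⊥n (+ suc k) _ (+<+ k<m) n∣xdg =
  ℕP.<⇒≱ k<m (ℕD.∣⇒≤ m∣x)
  where
  n∣gxd : n ∣ℕ ∣ g ∣ ℕ.* (suc k ℕ.* d)
  n∣gxd = subst (n ∣ℕ_) (trans (ℤP.abs-* (+ suc k) (+ d * g))
                        (trans (cong (suc k ℕ.*_) (ℤP.abs-* (+ d) g)) (reorder (suc k) d ∣ g ∣)))
                (∣⇒∣ᵤ n∣xdg)
    where reorder : ∀ x d g → x ℕ.* (d ℕ.* g) ≡ g ℕ.* (x ℕ.* d)
          reorder = ℕSolver.solve-∀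
  m∣x : m ∣ℕ suc k
  m∣x = ℕD.*-cancelʳ-∣ d (subst (_∣ℕ suc k ℕ.* d) n≡md
          (Coprimality.coprime-divisor (Coprimality.sym g⊥n) n∣gxd))
small-multiple-nonzero _ _ _ (+ zero) (+≤+ ()) _ _
small-multiple-nonzero _ _ _ -[1+ _ ] () _ _

-- Let h = d·g be of order m (n = m·d).  A sequence
-- congruent to (x₀h)(x₁h)(x₂h)(x₃h) with positive integers x_i summing to
-- m is a minimal zero-sum sequence: a proper nonempty subsequence sums to
-- X·h with 0 < X < m.
positive-coefficients⇒minimal : ∀ {n m d} .{{_ : ℕ.NonZero d}} → n ≡ m ℕ.* d →
  ∀ g → Coprime ∣ g ∣ n → (S x : Seq4) → (∀ i → + n ∣ₛ (S i - x i * (+ d * g))) →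
  (∀ i → + 1 ≤ x i) → sum4 x ≡ + m → MinimalZeroSum n S
positive-coefficients⇒minimal {n} {m} {d} n≡md g g⊥n S x S≡xh x≥1 Σx≡m =
  ∣⇒∣ᵤ zero-sum , no-proper-zero-subsum
  where
  h : ℤ
  h = + d * g
  zero-sum : + n ∣ₛ (sum4 S - + 0)
  zero-sum = subst (+ n ∣ₛ_) (regroup (sum4 S) (sum4 (λ i → x i * h)))
    (∣m∣n⇒∣m+n (sum4-cong S (λ i → x i * h) S≡xh)
               (subst (+ n ∣ₛ_) (sym Σxh≡ng) (∣m⇒∣m*n g (ℤD.∣-refl {+ n}))))
    where
    Σxh≡ng : sum4 (λ i → x i * h) ≡ + n * g
    Σxh≡ng = begin
      sum4 (λ i → x i * h) ≡⟨ sum4-*ʳ x h ⟩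
      sum4 x * h          ≡⟨ cong (_* h) Σx≡m ⟩
      + m * (+ d * g)     ≡⟨ ℤP.*-assoc (+ m) (+ d) g ⟨
      + m * + d * g       ≡⟨ cong (_* g) (trans (sym (ℤP.pos-* m d)) (cong +_ (sym n≡md))) ⟩
      + n * g             ∎
    regroup : ∀ s t → s - t + t ≡ s - + 0
    regroup = solve-∀
  no-proper-zero-subsum : ∀ T → NonemptyProper T → ¬ (subSum T S ≋ + 0 [mod n ])
  no-proper-zero-subsum T (nonempty , i , Tᵢ≡false) n∣Sₜ =
    small-multiple-nonzero n≡md g g⊥n X (subSum-positive T x x≥1 nonempty) X<m n∣Xh
    where
    X X′ : ℤ
    X = subSum T x
    X′ = subSum (λ j → not (T j)) x
    X+X′≡m : X + X′ ≡ + m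
    X+X′≡m = trans (subSum-complement T x) Σx≡m
    X<m : X < + m
    X<m = nonNeg⇒< (nonNeg-by (subst (λ k → k - X - + 1 ≡ X′ - + 1) X+X′≡m (cancel X X′))
                              (≤⇒nonNeg (subSum-positive (λ j → not (T j)) x x≥1 (i , cong not Tᵢ≡false))))
      where cancel : ∀ X X′ → X + X′ - X - + 1 ≡ X′ - + 1
            cancel = solve-∀
    n∣Xh : + n ∣ₛ X * h
    n∣Xh = subst (+ n ∣ₛ_) (trans (regroup (subSum T S) (subSum T (λ j → x j * h))) (subSum-*ʳ T x h))
             (∣m∣n⇒∣m-n (∣ᵤ⇒∣ {i = subSum T S - + 0} n∣Sₜ) (subSum-cong T S (λ j → x j * h) S≡xh))
      where regroup : ∀ s t → s - + 0 - (s - t) ≡ t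
            regroup = solve-∀

sum-of-coefficients : ∀ n h (S m : Seq4) → (∀ i → Coeff n h (S i) (m i)) →
                      + n ∣ₛ (sum4 S - sum4 m * h)
sum-of-coefficients n h S m coeff =
  subst (λ t → + n ∣ₛ (sum4 S - t)) (sum4-*ʳ m h)
        (sum4-cong S (λ i → m i * h) (λ i → ∣ᵤ⇒∣ (proj₂ (proj₂ (coeff i)))))

positive-multiple-≥ : ∀ {n M} → + n ∣ₛ M → + 1 ≤ M → + n ≤ M
positive-multiple-≥ {M = + suc t} n∣M _ = +≤+ (ℕD.∣⇒≤ (∣⇒∣ᵤ n∣M))
positive-multiple-≥ {M = + zero} _ (+≤+ ())
positive-multiple-≥ {M = -[1+ _ ]} _ ()

-- ‖S‖_h ≥ 1 for every zero-sum sequence S and generator h: the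
-- coefficients sum to M with M·h = 0, hence n ∣ M, and M > 0 since the
-- coefficients are positive.
norm-≥-1 : ∀ n (S : Seq4) h M → + n ∣ₛ sum4 S → Generates n h → NormNumerator n h S M → + n ≤ M
norm-≥-1 n S h M n∣ΣS gen (m , coeff , refl) =
  positive-multiple-≥ n∣M (subSum-positive (λ _ → true) m (λ i → proj₁ (coeff i)) (zero , refl))
  where
  k : ℤ
  k = proj₁ (gen (+ 1))
  n∣1-kh : + n ∣ₛ (+ 1 - k * h)
  n∣1-kh = ∣ᵤ⇒∣ (proj₂ (gen (+ 1)))
  n∣Mh : + n ∣ₛ (sum4 m * h)
  n∣Mh = subst (+ n ∣ₛ_) (regroup (sum4 S) (sum4 m * h))
                (∣m∣n⇒∣m-n n∣ΣS (sum-of-coefficients n h S m coeff))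
    where regroup : ∀ s t → s - (s - t) ≡ t
          regroup = solve-∀
  n∣M : + n ∣ₛ sum4 m
  n∣M = subst (+ n ∣ₛ_) (recombine (sum4 m) k h) (∣m∣n⇒∣m+n (∣n⇒∣m*n (sum4 m) n∣1-kh) (∣n⇒∣m*n k n∣Mh))
    where recombine : ∀ M k h → M * (+ 1 - k * h) + k * (M * h) ≡ M
          recombine = solve-∀

index-one-criterion : ∀ n (S : Seq4) h (m : Seq4) → Generates n h →
  (∀ i → Coeff n h (S i) (m i)) → sum4 m ≡ + n → IndexOne n S
index-one-criterion n S h m gen coeff Σm≡n =
  (h , gen , m , coeff , sym Σm≡n) , λ h′ gen′ M → norm-≥-1 n S h′ M n∣ΣS gen′
  where
  n∣ΣS : + n ∣ₛ sum4 S
  n∣ΣS = subst (+ n ∣ₛ_) (regroup (sum4 S) (+ n) h)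
           (∣m∣n⇒∣m+n (subst (λ M → + n ∣ₛ (sum4 S - M * h)) Σm≡n (sum-of-coefficients n h S m coeff))
                      (∣m⇒∣m*n h (ℤD.∣-refl {+ n})))
    where regroup : ∀ s N h → s - N * h + N * h ≡ s
          regroup = solve-∀

-- An element of order n is a unit: if d = gcd(g, n) > 1, then the
-- cofactor n/d satisfies (n/d)·g = 0 with 0 < n/d < n.
order-n⇒coprime : ∀ n g → HasOrder n g n → Coprime ∣ g ∣ n
order-n⇒coprime n g (0<n , _ , minimal) = Coprimality.gcd≡1⇒coprime gcd≡1
  where
  cofactor-annihilates : ∀ y a d → n ≡ y ℕ.* d → ∣ g ∣ ≡ a ℕ.* d → (+ y) * g ≋ + 0 [mod n ]
  cofactor-annihilates y a d n≡yd g≡ad = divides a (begin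
    ∣ + y * g - + 0 ∣    ≡⟨ cong ∣_∣ (ℤP.+-identityʳ (+ y * g)) ⟩
    ∣ + y * g ∣          ≡⟨ ℤP.abs-* (+ y) g ⟩
    y ℕ.* ∣ g ∣          ≡⟨ cong (y ℕ.*_) g≡ad ⟩
    y ℕ.* (a ℕ.* d)      ≡⟨ swap y a d ⟩
    a ℕ.* (y ℕ.* d)      ≡⟨ cong (a ℕ.*_) n≡yd ⟨
    a ℕ.* n              ∎)
    where swap : ∀ y a d → y ℕ.* (a ℕ.* d) ≡ a ℕ.* (y ℕ.* d)
          swap = ℕSolver.solve-∀
  gcd≡1 : gcd ∣ g ∣ n ≡ 1
  gcd≡1 with gcd ∣ g ∣ n | gcd[m,n]∣m ∣ g ∣ n | gcd[m,n]∣n ∣ g ∣ n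
  ... | zero  | _ | divides y n≡y*0 = ⊥-elim (ℕP.<⇒≢ 0<n (sym (trans n≡y*0 (ℕP.*-zeroʳ y))))
  ... | suc zero | _ | _ = refl
  ... | suc (suc e) | divides a g≡ad | divides zero n≡0 = ⊥-elim (ℕP.<⇒≢ 0<n (sym n≡0))
  ... | suc (suc e) | divides a g≡ad | divides (suc y) n≡yd =
    ⊥-elim (minimal (suc y) (s≤s z≤n) y<n (cofactor-annihilates (suc y) a (suc (suc e)) n≡yd g≡ad))
    where y<n : suc y ℕ.< n
          y<n = subst (suc y ℕ.<_) (sym n≡yd) (ℕP.m<m*n (suc y) (suc (suc e)) (s≤s (s≤s z≤n)))

inverse : ∀ x n → Coprime ∣ x ∣ n → ∃ λ w → + n ∣ₛ (w * x - + 1)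
inverse (+ k) n k⊥n with Coprimality.coprime-Bézout k⊥n
... | Bézout.+- u v 1+vn≡uk = + u , dividesₛ (+ v) (begin
  + u * + k - + 1         ≡⟨ cong (_- + 1) (ℤP.pos-* u k) ⟨
  + (u ℕ.* k) - + 1       ≡⟨ cong (λ t → + t - + 1) 1+vn≡uk ⟨
  + (1 ℕ.+ v ℕ.* n) - + 1 ≡⟨ cong (_- + 1) (trans (ℤP.pos-+ 1 (v ℕ.* n))
                                                     (cong (λ t → + 1 + t) (ℤP.pos-* v n))) ⟩
  + 1 + + v * + n - + 1   ≡⟨ cancel (+ v) (+ n) ⟩
  + v * + n               ∎)
  where cancel : ∀ v n → + 1 + v * n - + 1 ≡ v * n
        cancel = solve-∀
... | Bézout.-+ u v 1+uk≡vn = - + u , dividesₛ (- + v) (begin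
  - + u * + k - + 1       ≡⟨ negate (+ u) (+ k) ⟩
  - (+ 1 + + u * + k)     ≡⟨ cong (λ t → - (+ 1 + t)) (ℤP.pos-* u k) ⟨
  - (+ 1 + + (u ℕ.* k))   ≡⟨ cong -_ (ℤP.pos-+ 1 (u ℕ.* k)) ⟨
  - + (1 ℕ.+ u ℕ.* k)     ≡⟨ cong (λ t → - + t) 1+uk≡vn ⟩
  - + (v ℕ.* n)           ≡⟨ cong -_ (ℤP.pos-* v n) ⟩
  - (+ v * + n)           ≡⟨ ℤP.neg-distribˡ-* (+ v) (+ n) ⟩
  - + v * + n             ∎)
  where negate : ∀ u k → - u * k - + 1 ≡ - (+ 1 + u * k)
        negate = solve-∀
inverse -[1+ k ] n k⊥n with inverse (+ suc k) n k⊥n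
... | w , dividesₛ q wk-1≡qn = - w , dividesₛ q (trans (square w (+ suc k)) wk-1≡qn)
  where square : ∀ w k → - w * - k - + 1 ≡ w * k - + 1
        square = solve-∀

coefficient-via-inverse : ∀ {n} (U v g x μ t : ℤ) → μ ≡ x * U - t * + n →
  + n ∣ₛ (v * U - + 1) → x * g ≋ μ * (v * g) [mod n ]
coefficient-via-inverse {n} U v g x μ t refl n∣vU-1 = ∣⇒∣ᵤ (subst (+ n ∣ₛ_) (sym (expand (+ n) U v g x t))
  (∣m∣n⇒∣m-n (∣m⇒∣m*n (t * v * g) (ℤD.∣-refl {+ n})) (∣n⇒∣m*n (x * g) n∣vU-1)))
  where expand : ∀ N U v g x t → x * g - (x * U - t * N) * (v * g) ≡ N * (t * v * g) - x * g * (v * U - + 1)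
        expand = solve-∀

unit-multiple-generates : ∀ {n} (g w U v : ℤ) → + n ∣ₛ (w * g - + 1) → + n ∣ₛ (v * U - + 1) →
  Generates n (v * g)
unit-multiple-generates {n} g w U v n∣wg-1 n∣vU-1 x = x * w * U , ∣⇒∣ᵤ
  (subst (+ n ∣ₛ_) (sym (expand x w g v U))
    (∣n⇒∣m*n (- x) (∣m∣n⇒∣m+n (∣m∣n⇒∣m+n (∣m⇒∣m*n (v * U - + 1) n∣wg-1) n∣wg-1) n∣vU-1)))
  where expand : ∀ x w g v U → x - x * w * U * (v * g)
                   ≡ - x * ((w * g - + 1) * (v * U - + 1) + (w * g - + 1) + (v * U - + 1))
        expand = solve-∀

prime[5] : Prime 5
prime[5] = toWitness {a? = prime? 5} _

prime∣prime⇒≡ : ∀ {p q} → Prime p → Prime q → p ∣ℕ q → p ≡ q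
prime∣prime⇒≡ p-prime q-prime p∣q with prime⇒irreducible q-prime p∣q
... | inj₁ refl = ⊥-elim (¬prime[1] p-prime)
... | inj₂ p≡q  = p≡q

5∤1+5k : ∀ k → ¬ 5 ∣ℕ 1 ℕ.+ 5 ℕ.* k
5∤1+5k k 5∣1+5k = 5∤1 (ℕD.∣m+n∣m⇒∣n (subst (5 ∣ℕ_) (ℕP.+-comm 1 (5 ℕ.* k)) 5∣1+5k) (ℕD.m∣m*n k))
  where 5∤1 : ¬ 5 ∣ℕ 1
        5∤1 (divides zero ())
        5∤1 (divides (suc _) ())

coprime-6⇒≢2 : ∀ {n p} → Coprime n 6 → p ∣ℕ n → p ≢ 2
coprime-6⇒≢2 n⊥6 p∣n refl with n⊥6 (p∣n , divides 3 refl)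
... | ()

prime∤⇒coprime : ∀ {p U} → Prime p → ¬ p ∣ℕ U → Coprime U p
prime∤⇒coprime p-prime p∤U (d∣U , d∣p) with prime⇒irreducible p-prime d∣p
... | inj₁ d≡1 = d≡1
... | inj₂ refl = ⊥-elim (p∤U d∣U)

coprime-* : ∀ {U x y} → Coprime U x → Coprime U y → Coprime U (x ℕ.* y)
coprime-* U⊥x U⊥y (d∣U , d∣xy) =
  U⊥y (d∣U , Coprimality.coprime-divisor (λ (e∣d , e∣x) → U⊥x (ℕD.∣-trans e∣d d∣U , e∣x)) d∣xy)

five-among-factors : ∀ {p₁ p₂ p₃} → Prime p₁ → Prime p₂ → Prime p₃ → 5 ∣ℕ p₁ ℕ.* p₂ ℕ.* p₃ →
  ∃₂ λ q r → Prime q × Prime r × p₁ ℕ.* p₂ ℕ.* p₃ ≡ 5 ℕ.* q ℕ.* r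
five-among-factors {p₁} {p₂} {p₃} p₁-prime p₂-prime p₃-prime 5∣n
  with euclidsLemma (p₁ ℕ.* p₂) p₃ prime[5] 5∣n
... | inj₂ 5∣p₃ with prime∣prime⇒≡ prime[5] p₃-prime 5∣p₃
...   | refl = p₁ , p₂ , p₁-prime , p₂-prime , trans (ℕP.*-comm (p₁ ℕ.* p₂) 5) (sym (ℕP.*-assoc 5 p₁ p₂))
five-among-factors {p₁} {p₂} {p₃} p₁-prime p₂-prime p₃-prime 5∣n | inj₁ 5∣p₁p₂
  with euclidsLemma p₁ p₂ prime[5] 5∣p₁p₂
... | inj₁ 5∣p₁ with prime∣prime⇒≡ prime[5] p₁-prime 5∣p₁
...   | refl = p₂ , p₃ , p₂-prime , p₃-prime , refl
five-among-factors {p₁} {p₂} {p₃} p₁-prime p₂-prime p₃-prime 5∣n | inj₁ 5∣p₁p₂ | inj₂ 5∣p₂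
  with prime∣prime⇒≡ prime[5] p₂-prime 5∣p₂
... | refl = p₁ , p₃ , p₁-prime , p₃-prime , cong (ℕ._* p₃) (ℕP.*-comm p₁ 5)

-- An odd prime dividing both y and y + 5k (k = 1, 2) divides 5k, hence
-- equals 5; this is impossible when 5 ∤ y.
no-common-odd-prime : ∀ {p} y k → Prime p → p ≢ 2 → ¬ 5 ∣ℕ y → p ∣ℕ y → p ∣ℕ y ℕ.+ 5 ℕ.* k →
                      k ≡ 1 ⊎ k ≡ 2 → ⊥
no-common-odd-prime {p} y k p-prime p≢2 5∤y p∣y p∣y+5k k∈12 =
  divides-5 (ℕD.∣m+n∣m⇒∣n p∣y+5k p∣y) k∈12
  where
  p≢5 : p ≡ 5 → ⊥
  p≢5 refl = 5∤y p∣y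
  divides-5 : p ∣ℕ 5 ℕ.* k → k ≡ 1 ⊎ k ≡ 2 → ⊥
  divides-5 p∣5 (inj₁ refl) = p≢5 (prime∣prime⇒≡ p-prime prime[5] p∣5)
  divides-5 p∣10 (inj₂ refl) with euclidsLemma 5 2 p-prime p∣10
  ... | inj₁ p∣5 = p≢5 (prime∣prime⇒≡ p-prime prime[5] p∣5)
  ... | inj₂ p∣2 = p≢2 (prime∣prime⇒≡ p-prime (toWitness {a? = prime? 2} _) p∣2)

-- One of x, x + 5, x + 10 (with 5 ∤ x) is divisible by neither of two odd
-- primes q, r: each of them divides at most one of the three numbers.
module _ {q r} (x : ℕ) (q-prime : Prime q) (r-prime : Prime r) (q≢2 : q ≢ 2) (r≢2 : r ≢ 2)
         (5∤x : ¬ 5 ∣ℕ x) where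
  private
    c : ℕ → ℕ
    c i = x ℕ.+ 5 ℕ.* i
    Good : ℕ → Set
    Good i = i ℕ.≤ 2 × ¬ q ∣ℕ c i × ¬ r ∣ℕ c i
    classify : ∀ i → i ℕ.≤ 2 → Good i ⊎ (q ∣ℕ c i ⊎ r ∣ℕ c i)
    classify i i≤2 with q ℕD.∣? c i | r ℕD.∣? c i
    ... | yes q∣cᵢ | _        = inj₂ (inj₁ q∣cᵢ)
    ... | no _     | yes r∣cᵢ = inj₂ (inj₂ r∣cᵢ)
    ... | no q∤cᵢ  | no r∤cᵢ  = inj₁ (i≤2 , q∤cᵢ , r∤cᵢ)
    5∤c : ∀ i → ¬ 5 ∣ℕ c i
    5∤c i 5∣c = 5∤x (ℕD.∣m+n∣m⇒∣n (subst (5 ∣ℕ_) (ℕP.+-comm x (5 ℕ.* i)) 5∣c) (ℕD.m∣m*n i))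
    clash₀₁ : ∀ {p} → Prime p → p ≢ 2 → p ∣ℕ c 0 → p ∣ℕ c 1 → ⊥
    clash₀₁ {p} pp p≢2 p∣c₀ p∣c₁ = no-common-odd-prime (c 0) 1 pp p≢2 (5∤c 0) p∣c₀
      (subst (p ∣ℕ_) (cong (ℕ._+ 5) (sym (ℕP.+-identityʳ x))) p∣c₁) (inj₁ refl)
    clash₀₂ : ∀ {p} → Prime p → p ≢ 2 → p ∣ℕ c 0 → p ∣ℕ c 2 → ⊥
    clash₀₂ {p} pp p≢2 p∣c₀ p∣c₂ = no-common-odd-prime (c 0) 2 pp p≢2 (5∤c 0) p∣c₀
      (subst (p ∣ℕ_) (cong (ℕ._+ 10) (sym (ℕP.+-identityʳ x))) p∣c₂) (inj₂ refl)
    clash₁₂ : ∀ {p} → Prime p → p ≢ 2 → p ∣ℕ c 1 → p ∣ℕ c 2 → ⊥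
    clash₁₂ {p} pp p≢2 p∣c₁ p∣c₂ = no-common-odd-prime (c 1) 1 pp p≢2 (5∤c 1) p∣c₁
      (subst (p ∣ℕ_) (sym (ℕP.+-assoc x 5 5)) p∣c₂) (inj₁ refl)

  avoid-two-primes : ∃ λ i → i ℕ.≤ 2 × ¬ q ∣ℕ x ℕ.+ 5 ℕ.* i × ¬ r ∣ℕ x ℕ.+ 5 ℕ.* i
  avoid-two-primes with classify 0 z≤n | classify 1 (s≤s z≤n) | classify 2 (s≤s (s≤s z≤n))
  ... | inj₁ good | _ | _ = 0 , good
  ... | _ | inj₁ good | _ = 1 , good
  ... | _ | _ | inj₁ good = 2 , good
  ... | inj₂ (inj₁ q∣c₀) | inj₂ (inj₁ q∣c₁) | _ = ⊥-elim (clash₀₁ q-prime q≢2 q∣c₀ q∣c₁)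
  ... | inj₂ (inj₂ r∣c₀) | inj₂ (inj₂ r∣c₁) | _ = ⊥-elim (clash₀₁ r-prime r≢2 r∣c₀ r∣c₁)
  ... | inj₂ (inj₁ q∣c₀) | _ | inj₂ (inj₁ q∣c₂) = ⊥-elim (clash₀₂ q-prime q≢2 q∣c₀ q∣c₂)
  ... | inj₂ (inj₂ r∣c₀) | _ | inj₂ (inj₂ r∣c₂) = ⊥-elim (clash₀₂ r-prime r≢2 r∣c₀ r∣c₂)
  ... | _ | inj₂ (inj₁ q∣c₁) | inj₂ (inj₁ q∣c₂) = ⊥-elim (clash₁₂ q-prime q≢2 q∣c₁ q∣c₂)
  ... | _ | inj₂ (inj₂ r∣c₁) | inj₂ (inj₂ r∣c₂) = ⊥-elim (clash₁₂ r-prime r≢2 r∣c₁ r∣c₂)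

-- The inequalities for U = 5J + 6 + 5I (0 ≤ I ≤ 2), where m = 5DJ + f
-- with 0 ≤ f < 5D, m > 6D and m ≥ 43.  The second is a certificate:
-- 3D·(5m − U − UD − 1) is a sum of products of nonnegative quantities.
multiplier-bounds : ∀ (d₀ : ℕ) (J f I : ℤ) →
  let D = + suc d₀ ; m = + 5 * D * J + f ; U = + 5 * J + + 6 + + 5 * I in
  NonNeg f → NonNeg (+ 5 * D - f - + 1) → NonNeg I → NonNeg (+ 2 - I) →
  NonNeg (m - + 1 - + 6 * D) → NonNeg (m - + 43) →
  NonNeg (U * D - m - + 1) × NonNeg (+ 5 * m - U - U * D - + 1)
multiplier-bounds d₀ J f I f≥0 f<5D I≥0 I≤2 m>6D m≥43 =
  nonNeg-by (lower-identity D J f I) (nonNeg-+ (nonNeg-* (nonNeg-+ (nonNeg-ℕ 1) (nonNeg-* (nonNeg-ℕ 5) I≥0)) D≥0) f<5D) ,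
  nonNeg-cancel (3 ℕ.* suc d₀) (+ 5 * m - U - U * D - + 1)
    (nonNeg-by (trans (cong (_* (+ 5 * m - U - U * D - + 1)) (ℤP.pos-* 3 (suc d₀))) (upper-certificate D J f I))
      (nonNeg-+ (nonNeg-+ (nonNeg-+ (nonNeg-+ (nonNeg-+ (nonNeg-+
        (nonNeg-* (nonNeg-* (nonNeg-ℕ 3) D≥0) f≥0)
        (nonNeg-* (nonNeg-ℕ 3) f≥0))
        (nonNeg-* (nonNeg-* (nonNeg-* (nonNeg-ℕ 15) I≤2) D≥0) D≥0))
        (nonNeg-* (nonNeg-* (nonNeg-ℕ 15) I≤2) D≥0))
        (nonNeg-* (nonNeg-* (nonNeg-ℕ 8) D≥0) m>6D))
        (nonNeg-* (nonNeg-* (nonNeg-ℕ 3) m≥0) (nonNeg-ℕ d₀)))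
        (nonNeg-* D≥0 m≥43)))
  where
  D m U : ℤ
  D = + suc d₀
  m = + 5 * D * J + f
  U = + 5 * J + + 6 + + 5 * I
  D≥0 : NonNeg D
  D≥0 = nonNeg-ℕ (suc d₀)
  m≥0 : NonNeg m
  m≥0 = nonNeg-by (shift m) (nonNeg-+ m≥43 (nonNeg-ℕ 43))
    where shift : ∀ m → m ≡ m - + 43 + + 43
          shift = solve-∀
  lower-identity : ∀ D J f I → (+ 5 * J + + 6 + + 5 * I) * D - (+ 5 * D * J + f) - + 1
                                ≡ (+ 1 + + 5 * I) * D + (+ 5 * D - f - + 1)
  lower-identity = solve-∀
  upper-certificate : ∀ D J f I → let m = + 5 * D * J + f ; U = + 5 * J + + 6 + + 5 * I in
    + 3 * D * (+ 5 * m - U - U * D - + 1)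
    ≡ + 3 * D * f + + 3 * f + + 15 * (+ 2 - I) * D * D + + 15 * (+ 2 - I) * D
      + + 8 * D * (m - + 1 - + 6 * D) + + 3 * m * (D - + 1) + D * (m - + 43)
  upper-certificate = solve-∀

record Multiplier (m D q r : ℕ) : Set where
  field
    U T : ℕ
    U≡1+5T : U ≡ 1 ℕ.+ 5 ℕ.* T
    5∤U : ¬ 5 ∣ℕ U
    q∤U : ¬ q ∣ℕ U
    r∤U : ¬ r ∣ℕ U
    m<UD : + m < + U * + D
    U+UD<5m : + U + + U * + D < + 5 * + m

-- Such a multiplier exists when 6D < m and m ≥ 43: with J = ⌊m/5D⌋ the
-- candidates 5J + 6, 5J + 11, 5J + 16 all satisfy the inequalities
-- (multiplier-bounds), and one of them avoids q and r (avoid-two-primes).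
multiplier : ∀ m d₀ {q r} → Prime q → Prime r → q ≢ 2 → r ≢ 2 →
             + 6 * + suc d₀ < + m → + 43 ≤ + m → Multiplier m (suc d₀) q r
multiplier m d₀ {q} {r} q-prime r-prime q≢2 r≢2 6D<m 43≤m = record
  { U = U ; T = 1 ℕ.+ J ℕ.+ i
  ; U≡1+5T = U≡1+5T
  ; 5∤U = subst (λ u → ¬ 5 ∣ℕ u) (sym U≡1+5T) (5∤1+5k (1 ℕ.+ J ℕ.+ i))
  ; q∤U = proj₁ (proj₂ (proj₂ chosen))
  ; r∤U = proj₂ (proj₂ (proj₂ chosen))
  ; m<UD = nonNeg⇒< (subst₂ (λ u k → NonNeg (u * + D - k - + 1)) (sym U≡) (sym m≡) (proj₁ bounds))
  ; U+UD<5m = nonNeg⇒< (nonNeg-by (regroup (+ U) (+ D) (+ m))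
      (subst₂ (λ u k → NonNeg (+ 5 * k - u - u * + D - + 1)) (sym U≡) (sym m≡) (proj₂ bounds)))
  }
  where
  D J f x : ℕ
  D = suc d₀
  J = m / (5 ℕ.* D)
  f = m % (5 ℕ.* D)
  x = 1 ℕ.+ 5 ℕ.* (1 ℕ.+ J)
  chosen : ∃ λ i → i ℕ.≤ 2 × ¬ q ∣ℕ x ℕ.+ 5 ℕ.* i × ¬ r ∣ℕ x ℕ.+ 5 ℕ.* i
  chosen = avoid-two-primes x q-prime r-prime q≢2 r≢2 (5∤1+5k (1 ℕ.+ J))
  i U : ℕ
  i = proj₁ chosen
  U = x ℕ.+ 5 ℕ.* i
  U≡1+5T : U ≡ 1 ℕ.+ 5 ℕ.* (1 ℕ.+ J ℕ.+ i)
  U≡1+5T = collect J i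
    where collect : ∀ J i → 1 ℕ.+ 5 ℕ.* (1 ℕ.+ J) ℕ.+ 5 ℕ.* i ≡ 1 ℕ.+ 5 ℕ.* (1 ℕ.+ J ℕ.+ i)
          collect = ℕSolver.solve-∀
  regroup : ∀ U D m → + 5 * m - (U + U * D) - + 1 ≡ + 5 * m - U - U * D - + 1
  regroup = solve-∀
  U≡ : + U ≡ + 5 * + J + + 6 + + 5 * + i
  U≡ = begin
    + (1 ℕ.+ 5 ℕ.* (1 ℕ.+ J) ℕ.+ 5 ℕ.* i)     ≡⟨ ℤP.pos-+ (1 ℕ.+ 5 ℕ.* (1 ℕ.+ J)) (5 ℕ.* i) ⟩
    + (1 ℕ.+ 5 ℕ.* (1 ℕ.+ J)) + + (5 ℕ.* i)   ≡⟨ cong₂ _+_ (ℤP.pos-+ 1 (5 ℕ.* (1 ℕ.+ J))) (ℤP.pos-* 5 i) ⟩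
    + 1 + + (5 ℕ.* (1 ℕ.+ J)) + + 5 * + i     ≡⟨ cong (λ t → + 1 + t + + 5 * + i)
                                                    (trans (ℤP.pos-* 5 (1 ℕ.+ J)) (cong (_*_ (+ 5)) (ℤP.pos-+ 1 J))) ⟩
    + 1 + + 5 * (+ 1 + + J) + + 5 * + i       ≡⟨ normalise (+ J) (+ i) ⟩
    + 5 * + J + + 6 + + 5 * + i               ∎
    where normalise : ∀ J i → + 1 + + 5 * (+ 1 + J) + + 5 * i ≡ + 5 * J + + 6 + + 5 * i
          normalise = solve-∀
  m≡ : + m ≡ + 5 * + D * + J + + f
  m≡ = begin
    + m                          ≡⟨ cong +_ (m≡m%n+[m/n]*n m (5 ℕ.* D)) ⟩
    + (f ℕ.+ J ℕ.* (5 ℕ.* D))    ≡⟨ ℤP.pos-+ f (J ℕ.* (5 ℕ.* D)) ⟩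
    + f + + (J ℕ.* (5 ℕ.* D))    ≡⟨ cong (_+_ (+ f)) (trans (ℤP.pos-* J (5 ℕ.* D)) (cong (_*_ (+ J)) (ℤP.pos-* 5 D))) ⟩
    + f + + J * (+ 5 * + D)      ≡⟨ normalise (+ f) (+ J) (+ D) ⟩
    + 5 * + D * + J + + f        ∎
    where normalise : ∀ f J D → f + J * (+ 5 * D) ≡ + 5 * D * J + f
          normalise = solve-∀
  bounds : NonNeg ((+ 5 * + J + + 6 + + 5 * + i) * + D - (+ 5 * + D * + J + + f) - + 1) ×
           NonNeg (+ 5 * (+ 5 * + D * + J + + f) - (+ 5 * + J + + 6 + + 5 * + i)
                   - (+ 5 * + J + + 6 + + 5 * + i) * + D - + 1)
  bounds = multiplier-bounds d₀ (+ J) (+ f) (+ i) (nonNeg-ℕ f)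
    (subst (λ k → NonNeg (k - + f - + 1)) (ℤP.pos-* 5 D) (<⇒nonNeg (+<+ (m%n<n m (5 ℕ.* D)))))
    (nonNeg-ℕ i) (≤⇒nonNeg (+≤+ (proj₁ (proj₂ chosen))))
    (subst (λ k → NonNeg (k - + 1 - + 6 * + D)) m≡ (nonNeg-by (reorder (+ m) (+ D)) (<⇒nonNeg 6D<m)))
    (subst (λ k → NonNeg (k - + 43)) m≡ (≤⇒nonNeg 43≤m))
    where reorder : ∀ m D → m - + 1 - + 6 * D ≡ m - + 6 * D - + 1
          reorder = solve-∀

-- Step 1: c = m.  Otherwise m < c < 2m, and reducing 1, c, n − b, n − a
-- modulo m shows that 5·S is congruent to the sequence with coefficients
-- 1, c − m, m − b, m − a with respect to 5g, an element of order m.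
-- These are positive and sum to m, so 5·S is a minimal zero-sum sequence
-- and S is not reduced.
reduced⇒c≡m : ∀ {n m} → n ≡ m ℕ.* 5 → ∀ g → Coprime ∣ g ∣ n → ∀ a b c → + 1 + c ≡ a + b →
      a ≤ b → b < + m → + m ≤ c → Reduced n g a b c → c ≡ + m
reduced⇒c≡m {n} {m} n≡5m g g⊥n a b c 1+c≡a+b a≤b b<m m≤c reduced with c ℤP.≟ + m
... | yes c≡m = c≡m
... | no c≢m = ⊥-elim (reduced 5 prime[5] (divides m n≡5m)
                (positive-coefficients⇒minimal n≡5m g g⊥n (λ i → + 5 * mkS n g a b c i) x congruent x≥1 Σx≡m))
  where
  x : Seq4
  x zero = + 1
  x (suc zero) = c - + m
  x (suc (suc zero)) = + m - b
  x (suc (suc (suc zero))) = + m - a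
  x≥1 : ∀ i → + 1 ≤ x i
  x≥1 zero = ℤP.≤-refl
  x≥1 (suc zero) = nonNeg⇒≤ (<⇒nonNeg (ℤP.≤∧≢⇒< m≤c (λ m≡c → c≢m (sym m≡c))))
  x≥1 (suc (suc zero)) = nonNeg⇒≤ (<⇒nonNeg b<m)
  x≥1 (suc (suc (suc zero))) = nonNeg⇒≤ (<⇒nonNeg (ℤP.≤-<-trans a≤b b<m))
  Σx≡m : sum4 x ≡ + m
  Σx≡m = trans (cong (λ t → + 1 + (t - + m) + (+ m - b) + (+ m - a)) c≡a+b-1) (telescope a b (+ m))
    where
    c≡a+b-1 : c ≡ a + b - + 1
    c≡a+b-1 = trans (unshift c) (cong (_- + 1) 1+c≡a+b)
      where unshift : ∀ c → c ≡ + 1 + c - + 1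
            unshift = solve-∀
    telescope : ∀ a b m → + 1 + (a + b - + 1 - m) + (m - b) + (m - a) ≡ m
    telescope = solve-∀
  n≡5m′ : + n ≡ + 5 * + m
  n≡5m′ = trans (cong +_ n≡5m) (trans (ℤP.pos-* m 5) (ℤP.*-comm (+ m) (+ 5)))
  reduce₂ : ∀ t m g → + 5 * ((+ 5 * m - t) * g) - (m - t) * (+ 5 * g) ≡ + 4 * g * (+ 5 * m)
  reduce₂ = solve-∀
  congruent : ∀ i → + n ∣ₛ (+ 5 * mkS n g a b c i - x i * (+ 5 * g))
  congruent zero = dividesₛ (+ 0) (vanish g)
    where vanish : ∀ g → + 5 * g - + 1 * (+ 5 * g) ≡ + 0 * (+ 5 * g)
          vanish = solve-∀
  congruent (suc zero) = subst (λ N → N ∣ₛ (+ 5 * (c * g) - (c - + m) * (+ 5 * g))) (sym n≡5m′)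
    (dividesₛ g (reduce₁ c (+ m) g))
    where reduce₁ : ∀ c m g → + 5 * (c * g) - (c - m) * (+ 5 * g) ≡ g * (+ 5 * m)
          reduce₁ = solve-∀
  congruent (suc (suc zero)) = subst (λ N → N ∣ₛ (+ 5 * ((N - b) * g) - (+ m - b) * (+ 5 * g)))
    (sym n≡5m′) (dividesₛ (+ 4 * g) (reduce₂ b (+ m) g))
  congruent (suc (suc (suc zero))) = subst (λ N → N ∣ₛ (+ 5 * ((N - a) * g) - (+ m - a) * (+ 5 * g)))
    (sym n≡5m′) (dividesₛ (+ 4 * g) (reduce₂ a (+ m) g))

-- Let c = m, a = 1 + D, b = m − D, and let U be a
-- multiplier prime to n, with inverse v modulo n.  With respect to the
-- generator h = v·g,
--   S = (U·h)(m·h)((UD − m)·h)((5m − U − UD)·h),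
-- whose coefficients lie in [1, n] and sum to 5m = n; so ind(S) = 1.
index-one-normal-form : ∀ {n m D q r} → + n ≡ + 5 * + m → ∀ g → Coprime ∣ g ∣ n →
  (M : Multiplier m D q r) → Coprime (Multiplier.U M) n → + 1 ≤ + m →
  IndexOne n (mkS n g (+ 1 + + D) (+ m - + D) (+ m))
index-one-normal-form {n} {m} {D} n≡5m g g⊥n M U⊥n 1≤m =
  index-one-criterion n S (v * g) μ (unit-multiple-generates g w (+ U) v wg≡1 vU≡1) coefficients Σμ≡n
  where
  open Multiplier M
  S : Seq4
  S = mkS n g (+ 1 + + D) (+ m - + D) (+ m)
  v w : ℤ
  v = proj₁ (inverse (+ U) n U⊥n)
  vU≡1 : + n ∣ₛ (v * + U - + 1)
  vU≡1 = proj₂ (inverse (+ U) n U⊥n)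
  w = proj₁ (inverse g n g⊥n)
  wg≡1 : + n ∣ₛ (w * g - + 1)
  wg≡1 = proj₂ (inverse g n g⊥n)
  U≡1+5T′ : + U ≡ + 1 + + 5 * + T
  U≡1+5T′ = trans (cong +_ U≡1+5T) (trans (ℤP.pos-+ 1 (5 ℕ.* T)) (cong (_+_ (+ 1)) (ℤP.pos-* 5 T)))
  μ : Seq4
  μ zero = + U
  μ (suc zero) = + m
  μ (suc (suc zero)) = + U * + D - + m
  μ (suc (suc (suc zero))) = + 5 * + m - + U - + U * + D
  UD≥0 : NonNeg (+ U * + D)
  UD≥0 = nonNeg-* (nonNeg-ℕ U) (nonNeg-ℕ D)
  5m-U-UD≥1 : NonNeg (+ 5 * + m - + U - + U * + D - + 1)
  5m-U-UD≥1 = nonNeg-by (regroup (+ U) (+ D) (+ m)) (<⇒nonNeg U+UD<5m)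
    where regroup : ∀ U D m → + 5 * m - U - U * D - + 1 ≡ + 5 * m - (U + U * D) - + 1
          regroup = solve-∀
  coefficient : ∀ x {y} → + 1 ≤ y → NonNeg (+ 5 * + m - y) → x ≋ y * (v * g) [mod n ] →
                Coeff n (v * g) x y
  coefficient x 1≤y y≤5m x≡yh = 1≤y , nonNeg⇒≤ (subst (λ N → NonNeg (N - _)) (sym n≡5m) y≤5m) , x≡yh
  coefficients : ∀ i → Coeff n (v * g) (S i) (μ i)
  coefficients zero = coefficient (S zero)
    (nonNeg⇒≤ (nonNeg-by (trans (cong (_- + 1) U≡1+5T′) (cancel (+ T))) (nonNeg-* (nonNeg-ℕ 5) (nonNeg-ℕ T))))
    (nonNeg-by (room (+ U) (+ D) (+ m)) (nonNeg-+ (nonNeg-+ 5m-U-UD≥1 UD≥0) (nonNeg-ℕ 1)))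
    (subst (λ t → t ≋ + U * (v * g) [mod n ]) (ℤP.*-identityˡ g)
      (coefficient-via-inverse (+ U) v g (+ 1) (+ U) (+ 0) (unit (+ U) (+ n)) vU≡1))
    where
    cancel : ∀ T → + 1 + + 5 * T - + 1 ≡ + 5 * T
    cancel = solve-∀
    room : ∀ U D m → + 5 * m - U ≡ + 5 * m - U - U * D - + 1 + U * D + + 1
    room = solve-∀
    unit : ∀ U N → U ≡ + 1 * U - + 0 * N
    unit = solve-∀
  coefficients (suc zero) = coefficient (S (suc zero)) 1≤m (nonNeg-by (times-4 (+ m)) (nonNeg-* (nonNeg-ℕ 4) (nonNeg-ℕ m)))
    (coefficient-via-inverse (+ U) v g (+ m) (+ m) (+ T)
      (subst₂ (λ u N → + m ≡ + m * u - + T * N) (sym U≡1+5T′) (sym n≡5m) (reduce (+ m) (+ T))) vU≡1)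
    where
    times-4 : ∀ m → + 5 * m - m ≡ + 4 * m
    times-4 = solve-∀
    reduce : ∀ m T → m ≡ m * (+ 1 + + 5 * T) - T * (+ 5 * m)
    reduce = solve-∀
  coefficients (suc (suc zero)) = coefficient (S (suc (suc zero))) (nonNeg⇒≤ (<⇒nonNeg m<UD))
    (nonNeg-by (room (+ U) (+ D) (+ m)) (nonNeg-+ (nonNeg-+ (nonNeg-+ 5m-U-UD≥1 (nonNeg-ℕ m)) (nonNeg-ℕ U)) (nonNeg-ℕ 1)))
    (coefficient-via-inverse (+ U) v g (+ n - (+ m - + D)) (+ U * + D - + m) (+ U - + T)
      (subst₂ (λ u N → u * + D - + m ≡ (N - (+ m - + D)) * u - (u - + T) * N) (sym U≡1+5T′) (sym n≡5m)
              (reduce (+ m) (+ D) (+ T))) vU≡1)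
    where
    room : ∀ U D m → + 5 * m - (U * D - m) ≡ + 5 * m - U - U * D - + 1 + m + U + + 1
    room = solve-∀
    reduce : ∀ m D T → (+ 1 + + 5 * T) * D - m
                       ≡ (+ 5 * m - (m - D)) * (+ 1 + + 5 * T) - ((+ 1 + + 5 * T) - T) * (+ 5 * m)
    reduce = solve-∀
  coefficients (suc (suc (suc zero))) = coefficient (S (suc (suc (suc zero)))) (nonNeg⇒≤ 5m-U-UD≥1)
    (nonNeg-by (room (+ U) (+ D) (+ m)) (nonNeg-+ (nonNeg-ℕ U) UD≥0))
    (coefficient-via-inverse (+ U) v g (+ n - (+ 1 + + D)) (+ 5 * + m - + U - + U * + D) (+ U - + 1)
      (subst (λ N → + 5 * + m - + U - + U * + D ≡ (N - (+ 1 + + D)) * + U - (+ U - + 1) * N) (sym n≡5m)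
             (reduce (+ m) (+ U) (+ D))) vU≡1)
    where
    room : ∀ U D m → + 5 * m - (+ 5 * m - U - U * D) ≡ U + U * D
    room = solve-∀
    reduce : ∀ m U D → + 5 * m - U - U * D ≡ (+ 5 * m - (+ 1 + D)) * U - (U - + 1) * (+ 5 * m)
    reduce = solve-∀
  Σμ≡n : sum4 μ ≡ + n
  Σμ≡n = trans (telescope (+ U) (+ D) (+ m)) (sym n≡5m)
    where telescope : ∀ U D m → U + m + (U * D - m) + (+ 5 * m - U - U * D) ≡ + 5 * m
          telescope = solve-∀

parameters : ∀ {n m} a b → + n ≡ + 5 * + m → + 1 + + m ≡ a + b → + n - a < + n - + 1 →
  + n < + 6 * b → ∃ λ d₀ → a ≡ + 1 + + suc d₀ × b ≡ + m - + suc d₀ × + 6 * + suc d₀ < + m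
parameters {n} {m} a b n≡5m 1+m≡a+b n-a<n-1 n<6b =
  d₀ , a≡1+D , b≡m-D ,
  nonNeg⇒< (nonNeg-by (rearrange (+ m) D) (subst₂ (λ N t → NonNeg (+ 6 * t - N - + 1)) n≡5m b≡m-D (<⇒nonNeg n<6b)))
  where
  a≥2 : NonNeg (a - + 2)
  a≥2 = nonNeg-by (flip a (+ n)) (<⇒nonNeg n-a<n-1)
    where flip : ∀ a N → a - + 2 ≡ N - + 1 - (N - a) - + 1
          flip = solve-∀
  d₀ : ℕ
  d₀ = proj₁ a≥2
  D : ℤ
  D = + suc d₀
  a≡1+D : a ≡ + 1 + D
  a≡1+D = trans (shift a) (cong (λ t → + 2 + t) (proj₂ a≥2))
    where shift : ∀ a → a ≡ + 2 + (a - + 2)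
          shift = solve-∀
  b≡m-D : b ≡ + m - D
  b≡m-D = trans (isolate a b) (trans (cong₂ _-_ (sym 1+m≡a+b) a≡1+D) (cancel (+ m) D))
    where isolate : ∀ a b → b ≡ a + b - a
          isolate = solve-∀
          cancel : ∀ m D → + 1 + m - (+ 1 + D) ≡ m - D
          cancel = solve-∀
  rearrange : ∀ m D → m - + 6 * D - + 1 ≡ + 6 * (m - D) - + 5 * m - + 1
  rearrange = solve-∀

multiplier-prime-to-n : ∀ {n m p₁ p₂ p₃} d₀ → Prime p₁ → Prime p₂ → Prime p₃ →
  n ≡ p₁ ℕ.* p₂ ℕ.* p₃ → Coprime n 6 → 5 ∣ℕ n → + 6 * + suc d₀ < + m → + 43 ≤ + m →
  ∃₂ λ q r → Σ (Multiplier m (suc d₀) q r) λ M → Coprime (Multiplier.U M) n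
multiplier-prime-to-n {n} {m} d₀ p₁-prime p₂-prime p₃-prime refl n⊥6 5∣n 6D<m 43≤m
  with five-among-factors p₁-prime p₂-prime p₃-prime 5∣n
... | q , r , q-prime , r-prime , n≡5qr =
  q , r , M , subst (Coprime U) (sym n≡5qr)
    (coprime-* (coprime-* (prime∤⇒coprime prime[5] 5∤U) (prime∤⇒coprime q-prime q∤U)) (prime∤⇒coprime r-prime r∤U))
  where
  q≢2 : q ≢ 2
  q≢2 = coprime-6⇒≢2 n⊥6 (subst (q ∣ℕ_) (sym n≡5qr) (ℕD.n∣m*n*o 5 r))
  r≢2 : r ≢ 2
  r≢2 = coprime-6⇒≢2 n⊥6 (subst (r ∣ℕ_) (sym n≡5qr) (ℕD.n∣m*n (5 ℕ.* q)))
  M : Multiplier m (suc d₀) q r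
  M = multiplier m d₀ q-prime r-prime q≢2 r≢2 6D<m 43≤m
  open Multiplier M

lemma4p2 : (n p₁ p₂ p₃ : ℕ) →
    Prime p₁ → Prime p₂ → Prime p₃ →
    p₁ ≢ p₂ → p₁ ≢ p₃ → p₂ ≢ p₃ →
    n ≡ p₁ ℕ.* p₂ ℕ.* p₃ →
    Coprime n 6 →
    1000 ℕ.< n →
    (g : ℤ) → HasOrder n g n →
    (a b c : ℤ) →
    + 1 + c ≡ a + b →
    + 1 < c →
    + 2 * c < + n →
    + n < + 2 * (+ n - b) →
    + n - b ≤ + n - a →
    + n - a < + n - + 1 →
    MinimalZeroSum n (mkS n g a b c) →
    Reduced n g a b c →
    (CondA2 n a b c ⊎ CondA3 n a b c ⊎ CondA4 n a b c) →
    (s : ℤ) → s * a ≤ b → b < (s + + 1) * a →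
    s ≤ + 9 →
    CondB n b s →
    + 4 * c < + n → + n ≤ + 5 * c →
    + 5 * b < + n → + n < + 6 * b →
    5 ℕD.∣ n →
    IndexOne n (mkS n g a b c)
lemma4p2 n p₁ p₂ p₃ p₁-prime p₂-prime p₃-prime _ _ _ n≡p₁p₂p₃ n⊥6 1000<n g g-order a b c 1+c≡a+b
         _ _ _ n-b≤n-a n-a<n-1 _ reduced _ _ _ _ _ _ _ n≤5c 5b<n n<6b 5∣n@(divides m n≡m*5) =
  let c≡m = reduced⇒c≡m n≡m*5 g g⊥n a b c 1+c≡a+b a≤b b<m m≤c reduced
      (d₀ , a≡1+D , b≡m-D , 6D<m) = parameters a b n≡5m (subst (λ t → + 1 + t ≡ a + b) c≡m 1+c≡a+b)
                                               n-a<n-1 n<6b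
      (_ , _ , M , U⊥n) = multiplier-prime-to-n d₀ p₁-prime p₂-prime p₃-prime n≡p₁p₂p₃ n⊥6 5∣n 6D<m 43≤m
  in subst (λ t → IndexOne n (mkS n g a b t)) (sym c≡m)
       (subst₂ (λ s t → IndexOne n (mkS n g s t (+ m))) (sym a≡1+D) (sym b≡m-D)
         (index-one-normal-form n≡5m g g⊥n M U⊥n (ℤP.≤-trans (+≤+ (s≤s z≤n)) 43≤m)))
  where
  g⊥n : Coprime ∣ g ∣ n
  g⊥n = order-n⇒coprime n g g-order
  n≡5m : + n ≡ + 5 * + m
  n≡5m = trans (cong +_ n≡m*5) (trans (ℤP.pos-* m 5) (ℤP.*-comm (+ m) (+ 5)))
  a≤b : a ≤ b
  a≤b = nonNeg⇒≤ (nonNeg-by (flip a b (+ n)) (≤⇒nonNeg n-b≤n-a))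
    where flip : ∀ a b N → b - a ≡ N - a - (N - b)
          flip = solve-∀
  b<m : b < + m
  b<m = ℤP.*-cancelˡ-<-nonNeg (+ 5) (subst (+ 5 * b <_) n≡5m 5b<n)
  m≤c : + m ≤ c
  m≤c = ℤP.*-cancelˡ-≤-pos (+ m) c (+ 5) (subst (_≤ + 5 * c) n≡5m n≤5c)
  43≤m : + 43 ≤ + m
  43≤m = ℤP.≤-trans (+≤+ (ℕP.m≤m+n 43 157))
           (ℤP.<⇒≤ (ℤP.*-cancelˡ-<-nonNeg (+ 5) (subst (+ 1000 <_) n≡5m (+<+ 1000<n))))
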